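{- Let $k\ge1$ be an integer, let $G=(V,E)$ be an undirected graph (multiedges allowed, no self-loops) with $E$ partitioned into unsafe edges $\mathscr{U}$ and safe edges $\mathscr{S}$ and nonnegative costs $\{c_e\}_{e\in E}$, let $r\in V$, and let $F\subseteq E$ be a feasible solution for $k$-FGC. Define the digraph $D=(V,A)$ as follows: for each unsafe edge $e=uv\in F\cap\mathscr{U}$, $A$ contains one bidirected pair $\{(u,v),(v,u)\}$ arising from $e$, and for each safe edge $e=uv\in F\cap\mathscr{S}$, $A$ contains $k+1$ (disjoint copies of) bidirected pairs arising from $e$; each arc is given the cost of the edge it arises from. Then $D$ contains an $r$-out $(k+1)$-arborescence of total cost at most $(k+1)c(F)$.
   Context: $F\subseteq E$ is feasible for $k$-FGC if for every $X\subseteq F\cap\mathscr{U}$ with $|X|\le k$, the subgraph $(V,F\setminus X)$ is connected; $c(F)=\sum_{e\in F}c_e$. An $r$-out arborescence in a digraph $D=(W,A)$ is a subgraph $(W,T)$ such that the undirected version of $T$ is acyclic and for every $v\in W\setminus\{r\}$ there is an $r\to v$ directed path in $(W,T)$. An $r$-out $(k+1)$-arborescence is a subgraph $(W,T)$ whose arc set can be partitioned into $k+1$ arc-disjoint $r$-out arborescences; its cost is the sum of the costs of its arcs.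
   Formalization: The nonnegative costs $c_e$ take rational values. -}

module Defs where

open import Data.Nat as ℕ using (ℕ; zero; suc)
open import Data.Fin using (Fin; zero; suc)
open import Data.Bool using (Bool; true; false; if_then_else_; _∧_; _∨_; not)
open import Data.Product using (Σ; ∃; ∃-syntax; _×_; _,_; proj₁; proj₂)
open import Data.Sum using (_⊎_)
open import Data.List using (List; []; _∷_)
open import Data.List.Relation.Unary.Unique.Propositional using (Unique)
open import Data.Integer using (+_)
open import Data.Rational using (ℚ; 0ℚ; _+_; _*_; _/_; _≤_)
open import Relation.Binary.PropositionalEquality using (_≡_; _≢_)
open import Relation.Nullary using (¬_)

sumFin : (n : ℕ) → (Fin n → ℚ) → ℚ
sumFin zero    f = 0ℚ
sumFin (suc n) f = f zero + sumFin n (λ i → f (suc i))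

countFin : (n : ℕ) → (Fin n → Bool) → ℕ
countFin zero    X = 0
countFin (suc n) X = (if X zero then 1 else 0) ℕ.+ countFin n (λ i → X (suc i))

sumArcs : (m k : ℕ) → (Fin m × Fin (suc k) × Bool → ℚ) → ℚ
sumArcs m k f = sumFin m (λ e → sumFin (suc k) (λ i → f (e , i , true) + f (e , i , false)))

-- Undirected multigraph G = (V, E): V = Fin n, E = Fin m,
-- ends e = the two endpoints of edge e.

Ends : ℕ → ℕ → Set
Ends n m = Fin m → Fin n × Fin n

NoLoops : {n m : ℕ} → Ends n m → Set
NoLoops ends = ∀ e → proj₁ (ends e) ≢ proj₂ (ends e)

data EWalk {n m : ℕ} (ends : Ends n m) (H : Fin m → Bool) : Fin n → Fin n → Set where
  ewnil  : ∀ {v} → EWalk ends H v v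
  ewcons : ∀ {u w x} (e : Fin m) → H e ≡ true →
           ((proj₁ (ends e) ≡ u × proj₂ (ends e) ≡ w) ⊎ (proj₂ (ends e) ≡ u × proj₁ (ends e) ≡ w)) →
           EWalk ends H w x → EWalk ends H u x

Connected : {n m : ℕ} → Ends n m → (Fin m → Bool) → Set
Connected ends H = ∀ u v → EWalk ends H u v

-- safe e ≡ true : e ∈ 𝒮 ;  safe e ≡ false : e ∈ 𝒰.
-- F is feasible for k-FGC.
FeasibleFGC : {n m : ℕ} → ℕ → Ends n m → (safe : Fin m → Bool) → (F : Fin m → Bool) → Set
FeasibleFGC {n} {m} k ends safe F =
  (X : Fin m → Bool) →
  (∀ e → X e ≡ true → (F e ≡ true × safe e ≡ false)) →
  countFin m X ℕ.≤ k →
  Connected ends (λ e → F e ∧ not (X e))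

costE : {m : ℕ} → (c : Fin m → ℚ) → (F : Fin m → Bool) → ℚ
costE {m} c F = sumFin m (λ e → if F e then c e else 0ℚ)

-- The digraph D = (V, A).  A potential arc is (e , i , d): the i-th copy of
-- the bidirected pair arising from edge e, in direction d
-- (d = true : ends₁ → ends₂, d = false : ends₂ → ends₁).

Arc : ℕ → ℕ → Set
Arc m k = Fin m × Fin (suc k) × Bool

-- Arcs actually present in D: e ∈ F, and the copy index is 0 if e is unsafe
-- (one pair), arbitrary among k+1 copies if e is safe.
InD : {m : ℕ} (k : ℕ) → (safe F : Fin m → Bool) → Arc m k → Set
InD k safe F (e , i , d) = F e ≡ true × (safe e ≡ true ⊎ i ≡ zero)

tailA : {n m k : ℕ} → Ends n m → Arc m k → Fin n
tailA ends (e , i , true)  = proj₁ (ends e)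
tailA ends (e , i , false) = proj₂ (ends e)

headA : {n m k : ℕ} → Ends n m → Arc m k → Fin n
headA ends (e , i , true)  = proj₂ (ends e)
headA ends (e , i , false) = proj₁ (ends e)

costA : {m k : ℕ} → (Fin m → ℚ) → Arc m k → ℚ
costA c (e , i , d) = c e

data DWalk {n m k : ℕ} (ends : Ends n m) (T : Arc m k → Bool) : Fin n → Fin n → Set where
  dwnil  : ∀ {v} → DWalk ends T v v
  dwcons : ∀ {x} (a : Arc m k) → T a ≡ true →
           DWalk ends T (headA ends a) x → DWalk ends T (tailA ends a) x

data UWalk {n m k : ℕ} (ends : Ends n m) (T : Arc m k → Bool) : Fin n → Fin n → List (Arc m k) → Set where
  uwnil  : ∀ {v} → UWalk ends T v v []
  uwcons : ∀ {u w x as} (a : Arc m k) → T a ≡ true →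
           ((tailA ends a ≡ u × headA ends a ≡ w) ⊎ (headA ends a ≡ u × tailA ends a ≡ w)) →
           UWalk ends T w x as → UWalk ends T u x (a ∷ as)

HasCycle : {n m k : ℕ} → Ends n m → (Arc m k → Bool) → Set
HasCycle {n} {m} {k} ends T =
  Σ (Fin n) λ v → Σ (Arc m k) λ a → Σ (List (Arc m k)) λ as →
    UWalk ends T v v (a ∷ as) × Unique (a ∷ as)

OutArborescence : {n m k : ℕ} → Ends n m → Fin n → (Arc m k → Bool) → Set
OutArborescence {n} ends r T =
  ¬ HasCycle ends T × (∀ (v : Fin n) → v ≢ r → DWalk ends T r v)

costArcs : {m k : ℕ} → (Fin m → ℚ) → (Arc m k → Bool) → ℚ
costArcs {m} {k} c T = sumArcs m k (λ a → if T a then costA c a else 0ℚ)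

-- D contains an r-out (k+1)-arborescence of cost at most B: an arc set
-- T ⊆ A that is partitioned into k+1 pairwise arc-disjoint r-out arborescences.
HasOutKArborescence : {n m : ℕ} (k : ℕ) → Ends n m → (safe F : Fin m → Bool) →
                      (c : Fin m → ℚ) → Fin n → ℚ → Set
HasOutKArborescence {n} {m} k ends safe F c r B =
  Σ (Arc m k → Bool) λ T →
  Σ (Fin (suc k) → Arc m k → Bool) λ Ts →
    (∀ a → T a ≡ true → InD k safe F a) ×
    (∀ a → T a ≡ true → Σ (Fin (suc k)) λ j → Ts j a ≡ true) ×
    (∀ j a → Ts j a ≡ true → T a ≡ true) ×
    (∀ j j′ a → Ts j a ≡ true → Ts j′ a ≡ true → j ≡ j′) ×
    (∀ j → OutArborescence ends r (Ts j)) ×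
    costArcs c T ≤ B

{-# OPTIONS --safe #-}
-- D is rooted (k+1)-arc-connected from r.  A vertex set X ∌ r is entered by all k+1 copies of
-- an arc for every safe edge of F crossing it, and by at least one arc for every edge of F
-- crossing it; if neither yields k+1 entering arcs, the crossing edges are at most k unsafe
-- edges whose removal separates r from X, contradicting feasibility.  Edmonds' branching
-- theorem then gives k+1 arc-disjoint r-out arborescences.  It is proved following Lovász: one
-- arborescence is grown arc by arc while the unused arcs stay rooted k-connected, and the
-- submodularity of the in-degree ρ shows that a suitable arc always exists.  Two arcs arising
-- from the same edge would form a cycle, so each arborescence uses at most one arc per edge of F
-- and costs at most c(F).
module Submission where

open import Defs

module Arborescences where

  open import Data.Bool using (Bool; true; false; _∧_; _∨_; not; _xor_; if_then_else_; T)
  open import Data.Bool.Instances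
  open import Data.Bool.Properties using (¬-not; ∧-identityʳ)
  open import Data.Empty using (⊥; ⊥-elim)
  open import Data.Fin using (Fin; zero; suc)
  open import Data.Fin.Instances
  open import Data.Fin.Properties using (any?; suc-injective)
  open import Data.Fin.Subset.Properties using (anySubset?)
  open import Data.List using ([]; _∷_)
  open import Data.List.Membership.Propositional using (_∈_)
  open import Data.List.Relation.Unary.All using ([]; _∷_)
  open import Data.List.Relation.Unary.All.Properties using (All¬⇒¬Any)
  open import Data.List.Relation.Unary.AllPairs using ([]; _∷_)
  open import Data.List.Relation.Unary.Any using (here; there)
  open import Data.List.Relation.Unary.Unique.Propositional using (Unique)
  open import Data.Nat using (ℕ; zero; suc; _+_; _≤_; _<_; z≤n; s≤s; _≤ᵇ_; _<?_; _≤?_)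
  open import Data.Nat.Properties hiding (_≟_; suc-injective)
  open import Algebra.Properties.CommutativeSemigroup +-commutativeSemigroup using (interchange; xy∙z≈xz∙y)
  open import Data.Product using (Σ; ∃; _×_; _,_; proj₁; proj₂; map₂)
  open import Data.Product.Instances
  open import Data.Sum using (_⊎_; inj₁; inj₂)
  open import Data.Vec using (lookup; tabulate)
  import Data.Vec.Functional as Vector
  open import Data.Vec.Properties using (lookup∘tabulate)
  open import Function using (_∘_; case_of_)
  open import Relation.Binary.PropositionalEquality using (_≡_; _≢_; refl; sym; trans; cong; cong₂; subst)
  open import Relation.Binary.Structures using (IsDecEquivalence)
  open import Relation.Binary.TypeClasses using (_≟_)
  open import Relation.Nullary using (¬_; Dec; yes; no)
  open import Relation.Nullary.Decidable using (isYes; map′; _×-dec_; _⊎-dec_)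

  x∧y≡true⇒x≡true : ∀ {x y} → x ∧ y ≡ true → x ≡ true
  x∧y≡true⇒x≡true {true} _ = refl

  x∧y≡true⇒y≡true : ∀ {x y} → x ∧ y ≡ true → y ≡ true
  x∧y≡true⇒y≡true {true} y≡true = y≡true

  x∨y≡true⇒x≡true⊎y≡true : ∀ {x y} → x ∨ y ≡ true → x ≡ true ⊎ y ≡ true
  x∨y≡true⇒x≡true⊎y≡true {true}  _       = inj₁ refl
  x∨y≡true⇒x≡true⊎y≡true {false} y≡true = inj₂ y≡true

  not≡true⇒≡false : ∀ {x} → not x ≡ true → x ≡ false
  not≡true⇒≡false {false} _ = refl

  not≡false⇒≡true : ∀ {x} → not x ≡ false → x ≡ true
  not≡false⇒≡true {true} _ = refl

  x≡true⇒x∨y≡true : ∀ {x} y → x ≡ true → x ∨ y ≡ true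
  x≡true⇒x∨y≡true y refl = refl

  y≡true⇒x∨y≡true : ∀ x {y} → y ≡ true → x ∨ y ≡ true
  y≡true⇒x∨y≡true true  _       = refl
  y≡true⇒x∨y≡true false y≡true = y≡true

  [_] : Bool → ℕ
  [ b ] = if b then 1 else 0

  ≢-true-false : ∀ {x} → x ≡ true → x ≡ false → ⊥
  ≢-true-false refl ()

  []-mono-≤ : ∀ {x y} → (x ≡ true → y ≡ true) → [ x ] ≤ [ y ]
  []-mono-≤ {false}         _   = z≤n
  []-mono-≤ {true}  {true}  _   = ≤-refl
  []-mono-≤ {true}  {false} x⇒y with () ← x⇒y refl

  []-positive : ∀ {x} → 0 < [ x ] → x ≡ true
  []-positive {true} _ = refl

  []≤1 : ∀ x → [ x ] ≤ 1
  []≤1 false = z≤n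
  []≤1 true  = ≤-refl

  []-strict : ∀ {x y} → x ≡ false → y ≡ true → [ x ] < [ y ]
  []-strict refl refl = s≤s z≤n

  x∧[y∧¬z]⁺ : ∀ {x y z} → x ≡ true → y ≡ true → z ≡ false → x ∧ (y ∧ not z) ≡ true
  x∧[y∧¬z]⁺ refl refl refl = refl

  x∧[y∧¬z]⁻ : ∀ x y z → x ∧ (y ∧ not z) ≡ true → x ≡ true × y ≡ true × z ≡ false
  x∧[y∧¬z]⁻ true true false _ = refl , refl , refl

  ¬[x∨y]⇒¬x : ∀ x y → not (x ∨ y) ≡ true → not x ≡ true
  ¬[x∨y]⇒¬x false y _ = refl

  x∧¬[y∨z]≡[x∧¬y]∧¬z : ∀ x y z → x ∧ not (y ∨ z) ≡ (x ∧ not y) ∧ not z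
  x∧¬[y∨z]≡[x∧¬y]∧¬z true  true  z = refl
  x∧¬[y∨z]≡[x∧¬y]∧¬z true  false z = refl
  x∧¬[y∨z]≡[x∧¬y]∧¬z false y     z = refl

  private
    by-evaluation : ∀ {m n} {m≤ᵇn : T (m ≤ᵇ n)} → m ≤ n
    by-evaluation {m} {n} {m≤ᵇn} = ≤ᵇ⇒≤ m n m≤ᵇn

  entering-submodular : ∀ h x₁ x₂ z₁ z₂ →
    [ h ∧ ((x₁ ∧ z₁) ∧ not (x₂ ∧ z₂)) ] + [ h ∧ ((x₁ ∨ z₁) ∧ not (x₂ ∨ z₂)) ] ≤
    [ h ∧ (x₁ ∧ not x₂) ] + [ h ∧ (z₁ ∧ not z₂) ]
  entering-submodular false _     _     _     _     = z≤n
  entering-submodular true  false false false false = by-evaluation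
  entering-submodular true  false false false true  = by-evaluation
  entering-submodular true  false false true  false = by-evaluation
  entering-submodular true  false false true  true  = by-evaluation
  entering-submodular true  false true  false false = by-evaluation
  entering-submodular true  false true  false true  = by-evaluation
  entering-submodular true  false true  true  false = by-evaluation
  entering-submodular true  false true  true  true  = by-evaluation
  entering-submodular true  true  false false false = by-evaluation
  entering-submodular true  true  false false true  = by-evaluation
  entering-submodular true  true  false true  false = by-evaluation
  entering-submodular true  true  false true  true  = by-evaluation
  entering-submodular true  true  true  false false = by-evaluation
  entering-submodular true  true  true  false true  = by-evaluation
  entering-submodular true  true  true  true  false = by-evaluation
  entering-submodular true  true  true  true  true  = by-evaluation

  entering-difference : ∀ h xh sh xt st →
    [ h ∧ ((xh ∧ not sh) ∧ not (xt ∧ not st)) ] ≤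
    [ h ∧ (xh ∧ not xt) ] + [ h ∧ ((xt ∧ st) ∧ (xh ∧ not sh)) ]
  entering-difference false _     _     _     _     = z≤n
  entering-difference true  false _     _     _     = z≤n
  entering-difference true  true  true  _     _     = z≤n
  entering-difference true  true  false false _     = by-evaluation
  entering-difference true  true  false true  false = by-evaluation
  entering-difference true  true  false true  true  = by-evaluation

  module _ {A : Set} where

    infixl 7 _∩_
    infixl 6 _∪_ _∖_

    _∪_ _∩_ _∖_ : (A → Bool) → (A → Bool) → A → Bool
    (X ∪ Y) x = X x ∨ Y x
    (X ∩ Y) x = X x ∧ Y x
    (X ∖ Y) x = X x ∧ not (Y x)

    ∁ : (A → Bool) → A → Bool
    ∁ X x = not (X x)

    ∅ : A → Bool
    ∅ _ = false

    module _ {{decEq : IsDecEquivalence {A = A} _≡_}} where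

      ⁅_⁆ : A → A → Bool
      ⁅ a ⁆ x = isYes (x ≟ a)

      a∈⁅a⁆ : ∀ a → ⁅ a ⁆ a ≡ true
      a∈⁅a⁆ a with a ≟ a
      ... | yes _   = refl
      ... | no a≢a = ⊥-elim (a≢a refl)

      x∈⁅a⁆⇒x≡a : ∀ {a x} → ⁅ a ⁆ x ≡ true → x ≡ a
      x∈⁅a⁆⇒x≡a {a} {x} _ with x ≟ a
      ... | yes x≡a = x≡a

      x≢a⇒x∉⁅a⁆ : ∀ {a x} → x ≢ a → ⁅ a ⁆ x ≡ false
      x≢a⇒x∉⁅a⁆ {a} {x} x≢a with x ≟ a
      ... | yes x≡a = ⊥-elim (x≢a x≡a)
      ... | no _    = refl

  ∑ : (n : ℕ) → (Fin n → ℕ) → ℕ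
  ∑ zero    f = 0
  ∑ (suc n) f = f zero + ∑ n (f ∘ suc)

  ∑-cong : ∀ n {f g : Fin n → ℕ} → (∀ i → f i ≡ g i) → ∑ n f ≡ ∑ n g
  ∑-cong zero    f≡g = refl
  ∑-cong (suc n) f≡g = cong₂ _+_ (f≡g zero) (∑-cong n (f≡g ∘ suc))

  ∑-mono-≤ : ∀ n {f g : Fin n → ℕ} → (∀ i → f i ≤ g i) → ∑ n f ≤ ∑ n g
  ∑-mono-≤ zero    f≤g = z≤n
  ∑-mono-≤ (suc n) f≤g = +-mono-≤ (f≤g zero) (∑-mono-≤ n (f≤g ∘ suc))

  ∑-mono-< : ∀ n {f g : Fin n → ℕ} i → (∀ j → f j ≤ g j) → f i < g i → ∑ n f < ∑ n g
  ∑-mono-< (suc n) zero    f≤g fi<gi = +-mono-<-≤ fi<gi (∑-mono-≤ n (f≤g ∘ suc))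
  ∑-mono-< (suc n) (suc i) f≤g fi<gi = +-mono-≤-< (f≤g zero) (∑-mono-< n i (f≤g ∘ suc) fi<gi)

  ∑-distrib-+ : ∀ n (f g : Fin n → ℕ) → ∑ n (λ i → f i + g i) ≡ ∑ n f + ∑ n g
  ∑-distrib-+ zero    f g = refl
  ∑-distrib-+ (suc n) f g =
    trans (cong (f zero + g zero +_) (∑-distrib-+ n (f ∘ suc) (g ∘ suc)))
          (interchange (f zero) (g zero) (∑ n (f ∘ suc)) (∑ n (g ∘ suc)))

  term≤∑ : ∀ n (f : Fin n → ℕ) i → f i ≤ ∑ n f
  term≤∑ (suc n) f zero    = m≤m+n (f zero) _
  term≤∑ (suc n) f (suc i) = ≤-trans (term≤∑ n (f ∘ suc) i) (m≤n+m _ (f zero))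

  0<∑⇒∃0<term : ∀ n (f : Fin n → ℕ) → 0 < ∑ n f → ∃ λ i → 0 < f i
  0<∑⇒∃0<term (suc n) f 0<∑ with f zero in f0≡
  ... | suc _ = zero , subst (0 <_) (sym f0≡) (s≤s z≤n)
  ... | zero with 0<∑⇒∃0<term n (f ∘ suc) 0<∑
  ...   | i , 0<fi = suc i , 0<fi

  n≤∑-of-positives : ∀ n (f : Fin n → ℕ) → (∀ i → 0 < f i) → n ≤ ∑ n f
  n≤∑-of-positives zero    f pos = z≤n
  n≤∑-of-positives (suc n) f pos = +-mono-≤ (pos zero) (n≤∑-of-positives n (f ∘ suc) (pos ∘ suc))

  ∑-≤-except : ∀ n {f g : Fin n → ℕ} i x →
               (∀ j → j ≢ i → f j ≤ g j) → f i ≤ g i + x → ∑ n f ≤ ∑ n g + x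
  ∑-≤-except (suc n) {f} {g} zero x f≤g fi≤gi+x = begin
    f zero + ∑ n (f ∘ suc)   ≤⟨ +-mono-≤ fi≤gi+x (∑-mono-≤ n (λ j → f≤g (suc j) λ ())) ⟩
    g zero + x + ∑ n (g ∘ suc) ≡⟨ xy∙z≈xz∙y (g zero) x _ ⟩
    g zero + ∑ n (g ∘ suc) + x ∎
    where open ≤-Reasoning
  ∑-≤-except (suc n) {f} {g} (suc i) x f≤g fi≤gi+x = begin
    f zero + ∑ n (f ∘ suc)       ≤⟨ +-mono-≤ (f≤g zero λ ())
                                      (∑-≤-except n i x (λ j j≢i → f≤g (suc j) (j≢i ∘ suc-injective)) fi≤gi+x) ⟩
    g zero + (∑ n (g ∘ suc) + x) ≡⟨ +-assoc (g zero) _ x ⟨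
    g zero + ∑ n (g ∘ suc) + x   ∎
    where open ≤-Reasoning

  ∑₂ : (Bool → ℕ) → ℕ
  ∑₂ g = g true + g false

  ∑₂-mono-≤ : ∀ {f g : Bool → ℕ} → (∀ d → f d ≤ g d) → ∑₂ f ≤ ∑₂ g
  ∑₂-mono-≤ f≤g = +-mono-≤ (f≤g true) (f≤g false)

  ∑₂-≤-except : ∀ {f g : Bool → ℕ} d x →
                (∀ d′ → d′ ≢ d → f d′ ≤ g d′) → f d ≤ g d + x → ∑₂ f ≤ ∑₂ g + x
  ∑₂-≤-except {g = g} true  x f≤g fd≤gd+x =
    ≤-trans (+-mono-≤ fd≤gd+x (f≤g false λ ())) (≤-reflexive (xy∙z≈xz∙y (g true) x (g false)))
  ∑₂-≤-except {g = g} false x f≤g fd≤gd+x =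
    ≤-trans (+-mono-≤ (f≤g true λ ()) fd≤gd+x) (≤-reflexive (sym (+-assoc (g true) (g false) x)))

  0<∑₂⇒∃0<term : ∀ (g : Bool → ℕ) → 0 < ∑₂ g → ∃ λ d → 0 < g d
  0<∑₂⇒∃0<term g 0<∑ with g true in gtrue≡
  ... | suc _ = true , subst (0 <_) (sym gtrue≡) (s≤s z≤n)
  ... | zero  = false , 0<∑

  module _ {m k : ℕ} where

    ∑ₐ : (Arc m k → ℕ) → ℕ
    ∑ₐ f = ∑ m λ e → ∑ (suc k) λ i → ∑₂ λ d → f (e , i , d)

    ∑ₐ-cong : ∀ {f g : Arc m k → ℕ} → (∀ a → f a ≡ g a) → ∑ₐ f ≡ ∑ₐ g
    ∑ₐ-cong f≡g = ∑-cong m λ e → ∑-cong (suc k) λ i →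
      cong₂ _+_ (f≡g (e , i , true)) (f≡g (e , i , false))

    ∑ₐ-mono-≤ : ∀ {f g : Arc m k → ℕ} → (∀ a → f a ≤ g a) → ∑ₐ f ≤ ∑ₐ g
    ∑ₐ-mono-≤ f≤g = ∑-mono-≤ m λ e → ∑-mono-≤ (suc k) λ i → ∑₂-mono-≤ λ d → f≤g (e , i , d)

    ∑ₐ-distrib-+ : ∀ (f g : Arc m k → ℕ) → ∑ₐ (λ a → f a + g a) ≡ ∑ₐ f + ∑ₐ g
    ∑ₐ-distrib-+ f g = trans
      (∑-cong m λ e → trans
        (∑-cong (suc k) λ i → interchange (f (e , i , true)) (g (e , i , true)) (f (e , i , false)) (g (e , i , false)))
        (∑-distrib-+ (suc k) (λ i → ∑₂ λ d → f (e , i , d)) (λ i → ∑₂ λ d → g (e , i , d))))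
      (∑-distrib-+ m (λ e → ∑ (suc k) λ i → ∑₂ λ d → f (e , i , d))
                     (λ e → ∑ (suc k) λ i → ∑₂ λ d → g (e , i , d)))

    0<∑ₐ⇒∃0<term : ∀ (f : Arc m k → ℕ) → 0 < ∑ₐ f → ∃ λ a → 0 < f a
    0<∑ₐ⇒∃0<term f 0<∑ with 0<∑⇒∃0<term m _ 0<∑
    ... | e , 0<∑e with 0<∑⇒∃0<term (suc k) _ 0<∑e
    ... | i , 0<∑ei with 0<∑₂⇒∃0<term _ 0<∑ei
    ... | d , 0<fa = (e , i , d) , 0<fa

    0<∑ₐ[P]⇒∃P : ∀ (P : Arc m k → Bool) → 0 < ∑ₐ ([_] ∘ P) → ∃ λ a → P a ≡ true
    0<∑ₐ[P]⇒∃P P 0<∑ = map₂ []-positive (0<∑ₐ⇒∃0<term ([_] ∘ P) 0<∑)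

    ∑ₐ-≤-except : ∀ {f g : Arc m k → ℕ} a x →
                  (∀ b → b ≢ a → f b ≤ g b) → f a ≤ g a + x → ∑ₐ f ≤ ∑ₐ g + x
    ∑ₐ-≤-except (e , i , d) x f≤g fa≤ga+x =
      ∑-≤-except m e x
        (λ e′ e′≢e → ∑-mono-≤ (suc k) λ i′ → ∑₂-mono-≤ λ d′ → f≤g (e′ , i′ , d′) (e′≢e ∘ cong proj₁))
        (∑-≤-except (suc k) i x
          (λ i′ i′≢i → ∑₂-mono-≤ λ d′ → f≤g (e , i′ , d′) (i′≢i ∘ cong (proj₁ ∘ proj₂)))
          (∑₂-≤-except d x (λ d′ d′≢d → f≤g (e , i , d′) (d′≢d ∘ cong (proj₂ ∘ proj₂))) fa≤ga+x))

  anyArc? : ∀ {m k} {P : Arc m k → Set} → (∀ a → Dec (P a)) → Dec (∃ P)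
  anyArc? P? = map′ (λ (e , i , d , p) → (e , i , d) , p) (λ ((e , i , d) , p) → e , i , d , p)
    (any? λ e → any? λ i → anyBool? λ d → P? (e , i , d))
    where
    anyBool? : ∀ {P : Bool → Set} → (∀ d → Dec (P d)) → Dec (∃ P)
    anyBool? P? = map′ (λ { (inj₁ p) → true , p ; (inj₂ p) → false , p })
                       (λ { (true , p) → inj₁ p ; (false , p) → inj₂ p })
                       (P? true ⊎-dec P? false)

  module Edmonds {n m k : ℕ} (ends : Ends n m) (r : Fin n) where

    Arcs : Set
    Arcs = Arc m k → Bool

    Verts : Set
    Verts = Fin n → Bool

    tl hd : Arc m k → Fin n
    tl = tailA ends
    hd = headA ends

    entering : Arcs → Verts → Arcs
    entering H X = H ∩ (X ∘ hd ∖ X ∘ tl)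

    entering⁻ : ∀ H X a → entering H X a ≡ true → H a ≡ true × X (hd a) ≡ true × X (tl a) ≡ false
    entering⁻ H X a = x∧[y∧¬z]⁻ (H a) (X (hd a)) (X (tl a))

    ρ : Arcs → Verts → ℕ
    ρ H X = ∑ₐ ([_] ∘ entering H X)

    ∣_∣ : Verts → ℕ
    ∣ X ∣ = ∑ n ([_] ∘ X)

    ∣∣-mono-< : ∀ {X Y} u → (∀ v → Y v ≡ true → X v ≡ true) → X u ≡ true → Y u ≡ false → ∣ Y ∣ < ∣ X ∣
    ∣∣-mono-< u Y⊆X Xu Yu = ∑-mono-< n u (λ v → []-mono-≤ (Y⊆X v)) ([]-strict Yu Xu)

    ρ-congˡ : ∀ {G H} X → (∀ a → G a ≡ H a) → ρ G X ≡ ρ H X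
    ρ-congˡ X G≡H = ∑ₐ-cong λ a → cong (λ g → [ g ∧ (X (hd a) ∧ not (X (tl a))) ]) (G≡H a)

    ρ-congʳ : ∀ H {X Y} → (∀ v → X v ≡ Y v) → ρ H X ≡ ρ H Y
    ρ-congʳ H X≡Y = ∑ₐ-cong λ a → cong₂ (λ x y → [ H a ∧ (x ∧ not y) ]) (X≡Y (hd a)) (X≡Y (tl a))

    ρ-remove : ∀ D Z a → ρ D Z ≤ ρ (D ∖ ⁅ a ⁆) Z + [ entering D Z a ]
    ρ-remove D Z a = ∑ₐ-≤-except a _ unchanged (m≤n+m _ _)
      where
      unchanged : ∀ b → b ≢ a → [ entering D Z b ] ≤ [ entering (D ∖ ⁅ a ⁆) Z b ]
      unchanged b b≢a rewrite x≢a⇒x∉⁅a⁆ b≢a | ∧-identityʳ (D b) = ≤-refl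

    ρ-submodular : ∀ D X Z → ρ D (X ∩ Z) + ρ D (X ∪ Z) ≤ ρ D X + ρ D Z
    ρ-submodular D X Z = begin
      ρ D (X ∩ Z) + ρ D (X ∪ Z)
        ≡⟨ ∑ₐ-distrib-+ ([_] ∘ entering D (X ∩ Z)) ([_] ∘ entering D (X ∪ Z)) ⟨
      ∑ₐ (λ a → [ entering D (X ∩ Z) a ] + [ entering D (X ∪ Z) a ])
        ≤⟨ ∑ₐ-mono-≤ (λ a → entering-submodular (D a) (X (hd a)) (X (tl a)) (Z (hd a)) (Z (tl a))) ⟩
      ∑ₐ (λ a → [ entering D X a ] + [ entering D Z a ])
        ≡⟨ ∑ₐ-distrib-+ ([_] ∘ entering D X) ([_] ∘ entering D Z) ⟩
      ρ D X + ρ D Z ∎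
      where open ≤-Reasoning

    RootedConnected : ℕ → Arcs → Set
    RootedConnected K H = ∀ Z v → Z v ≡ true → Z r ≡ false → K ≤ ρ H Z

    Deficient : ℕ → Arcs → Verts → Set
    Deficient K H Z = (∃ λ v → Z v ≡ true) × Z r ≡ false × ρ H Z < K

    rootedConnected⊎deficient : ∀ K H → RootedConnected K H ⊎ ∃ (Deficient K H)
    rootedConnected⊎deficient K H with anySubset? (deficient? ∘ lookup)
      where
      deficient? : ∀ Z → Dec (Deficient K H Z)
      deficient? Z = any? (λ v → Z v ≟ true) ×-dec Z r ≟ false ×-dec ρ H Z <? K
    ... | yes (s , deficient) = inj₂ (lookup s , deficient)
    ... | no  none            = inj₁ λ Z v Zv Zr → ≮⇒≥ λ ρ<K →
      none (tabulate Z , (v , trans (lookup∘tabulate Z v) Zv) , trans (lookup∘tabulate Z r) Zr ,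
            subst (_< K) (ρ-congʳ H (sym ∘ lookup∘tabulate Z)) ρ<K)

    rootedConnected? : ∀ K H → Dec (RootedConnected K H)
    rootedConnected? K H with rootedConnected⊎deficient K H
    ... | inj₁ connected                       = yes connected
    ... | inj₂ (Z , (v , Zv) , Zr , ρ<K) = no λ connected → <⇒≱ ρ<K (connected Z v Zv Zr)

    DWalk-mono : ∀ {T T′ : Arcs} → (∀ a → T a ≡ true → T′ a ≡ true) →
                 ∀ {u v} → DWalk ends T u v → DWalk ends T′ u v
    DWalk-mono T⊆T′ dwnil              = dwnil
    DWalk-mono T⊆T′ (dwcons a Ta walk) = dwcons a (T⊆T′ a Ta) (DWalk-mono T⊆T′ walk)

    DWalk-++ : ∀ {T : Arcs} {u v w} → DWalk ends T u v → DWalk ends T v w → DWalk ends T u w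
    DWalk-++ dwnil              walk′ = walk′
    DWalk-++ (dwcons a Ta walk) walk′ = dwcons a Ta (DWalk-++ walk walk′)

    UWalk-restrict : ∀ {T B : Arcs} {a} → (∀ b → T b ≡ true → b ≢ a → B b ≡ true) →
                     ∀ {u v L} → UWalk ends T u v L → ¬ a ∈ L → UWalk ends B u v L
    UWalk-restrict T∖a⊆B uwnil                   a∉L = uwnil
    UWalk-restrict T∖a⊆B (uwcons b Tb step walk) a∉L =
      uwcons b (T∖a⊆B b Tb (a∉L ∘ here ∘ sym)) step (UWalk-restrict T∖a⊆B walk (a∉L ∘ there))

    Incident : Arc m k → Fin n → Set
    Incident b v = tl b ≡ v ⊎ hd b ≡ v

    Step : Arc m k → Fin n → Fin n → Set
    Step b u w = (tl b ≡ u × hd b ≡ w) ⊎ (hd b ≡ u × tl b ≡ w)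

    step-source : ∀ b {u w v} → Step b u w → u ≡ v → Incident b v
    step-source _ (inj₁ (tl≡u , _)) u≡v = inj₁ (trans tl≡u u≡v)
    step-source _ (inj₂ (hd≡u , _)) u≡v = inj₂ (trans hd≡u u≡v)

    step-target : ∀ b {u w v} → Step b u w → w ≡ v → Incident b v
    step-target _ (inj₁ (_ , hd≡w)) w≡v = inj₂ (trans hd≡w w≡v)
    step-target _ (inj₂ (_ , tl≡w)) w≡v = inj₁ (trans tl≡w w≡v)

    module PendantArc (T : Arcs) (a : Arc m k)
                      (pendant : ∀ b → T b ≡ true → Incident b (hd a) → b ≡ a) where

      trail-through-a-ends-at-hd : ∀ {u x L} → UWalk ends T u x L → u ≢ hd a → a ∈ L → Unique L → x ≡ hd a
      trail-through-a-ends-at-hd (uwcons b Tb step walk) u≢hd a∈L (b∉L ∷ unique) with b ≟ a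
      ... | yes refl with step
      ...   | inj₂ (hd≡u , _) = ⊥-elim (u≢hd (sym hd≡u))
      ...   | inj₁ (_ , hd≡w) with walk
      ...     | uwnil                = sym hd≡w
      ...     | uwcons c Tc step′ _ = ⊥-elim (All¬⇒¬Any b∉L (here (sym (pendant c Tc (step-source c step′ (sym hd≡w))))))
      trail-through-a-ends-at-hd (uwcons b Tb step walk) u≢hd (here a≡b)     _              | no b≢a = ⊥-elim (b≢a (sym a≡b))
      trail-through-a-ends-at-hd (uwcons b Tb step walk) u≢hd (there a∈L) (_ ∷ unique) | no b≢a =
        trail-through-a-ends-at-hd walk (λ w≡hd → b≢a (pendant b Tb (step-target b step w≡hd))) a∈L unique

      trail-to-hd-uses-a : ∀ {u x L} → UWalk ends T u x L → u ≢ hd a → x ≡ hd a → a ∈ L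
      trail-to-hd-uses-a uwnil u≢hd x≡hd = ⊥-elim (u≢hd x≡hd)
      trail-to-hd-uses-a (uwcons {w = w} b Tb step walk) u≢hd x≡hd with w ≟ hd a
      ... | yes w≡hd = here (sym (pendant b Tb (step-target b step w≡hd)))
      ... | no  w≢hd = there (trail-to-hd-uses-a walk w≢hd x≡hd)

      open import Data.List.Membership.DecPropositional (_≟_ {A = Arc m k}) using (_∈?_)

      pendant-acyclic : ∀ B → (∀ b → T b ≡ true → b ≢ a → B b ≡ true) → ¬ HasCycle ends B →
                        tl a ≢ hd a → ¬ HasCycle ends T
      pendant-acyclic B T∖a⊆B B-acyclic tl≢hd (v , a₀ , as , cycle , unique) with a ∈? (a₀ ∷ as)
      ... | no a∉cycle = B-acyclic (v , a₀ , as , UWalk-restrict T∖a⊆B cycle a∉cycle , unique)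
      ... | yes a∈cycle with v ≟ hd a
      ...   | no v≢hd = v≢hd (trail-through-a-ends-at-hd cycle v≢hd a∈cycle unique)
      ...   | yes v≡hd with cycle | unique
      ...     | uwcons _ T₀ step walk | a₀∉as ∷ _ with pendant a₀ T₀ (step-source a₀ step v≡hd)
      ...       | refl with step
      ...         | inj₁ (tl≡v , _) = tl≢hd (trans tl≡v v≡hd)
      ...         | inj₂ (_ , tl≡w) =
        All¬⇒¬Any a₀∉as (trail-to-hd-uses-a walk (λ w≡hd → tl≢hd (trans tl≡w w≡hd)) v≡hd)

    module Augmentation {K : ℕ} {H : Arcs} (H-connected : RootedConnected (suc K) H)
                        {S : Verts} {B : Arcs} (D-connected : RootedConnected K (H ∖ B))
                        (B-heads-in-S : ∀ a → B a ≡ true → S (hd a) ≡ true) (r∈S : S r ≡ true) where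

      D : Arcs
      D = H ∖ B

      Leaving : Arc m k → Set
      Leaving a = D a ≡ true × S (tl a) ≡ true × S (hd a) ≡ false

      leaving? : ∀ a → Dec (Leaving a)
      leaving? a = D a ≟ true ×-dec S (tl a) ≟ true ×-dec S (hd a) ≟ false

      Tight : Verts → Set
      Tight X = X r ≡ false × ρ D X ≤ K

      ρ-outside-S : ∀ Y → (∀ v → Y v ≡ true → S v ≡ false) → ρ H Y ≤ ρ D Y
      ρ-outside-S Y Y∩S≡∅ = ∑ₐ-mono-≤ λ a → []-mono-≤ (still-entering a)
        where
        still-entering : ∀ a → entering H Y a ≡ true → entering D Y a ≡ true
        still-entering a H-enters with entering⁻ H Y a H-enters | B a in Ba
        ... | _  , Yh , _   | true  = ⊥-elim (≢-true-false (B-heads-in-S a Ba) (Y∩S≡∅ (hd a) Yh))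
        ... | Ha , Yh , Ytl | false = x∧[y∧¬z]⁺ (cong (_∧ true) Ha) Yh Ytl

      -- Removing a lowers ρ D Z by at most one, and ρ D Z ≥ K.
      deficient-after-removal⇒tight : ∀ a Z → Deficient K (D ∖ ⁅ a ⁆) Z → Tight Z × Z (hd a) ≡ true × Z (tl a) ≡ false
      deficient-after-removal⇒tight a Z ((w , Zw) , Zr , ρ′<K) =
        (Zr , ρDZ≤K) , proj₂ (entering⁻ D Z a ([]-positive 0<[a-enters]))
        where
        open ≤-Reasoning
        ρ′ = ρ (D ∖ ⁅ a ⁆) Z
        [a-enters] = [ entering D Z a ]
        0<[a-enters] : 0 < [a-enters]
        0<[a-enters] = +-cancelˡ-≤ ρ′ 1 [a-enters] (begin
          ρ′ + 1              ≡⟨ +-comm ρ′ 1 ⟩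
          suc ρ′              ≤⟨ ρ′<K ⟩
          K                   ≤⟨ D-connected Z w Zw Zr ⟩
          ρ D Z               ≤⟨ ρ-remove D Z a ⟩
          ρ′ + [a-enters]     ∎)
        ρDZ≤K : ρ D Z ≤ K
        ρDZ≤K = begin
          ρ D Z               ≤⟨ ρ-remove D Z a ⟩
          ρ′ + [a-enters]     ≤⟨ +-monoʳ-≤ ρ′ ([]≤1 (entering D Z a)) ⟩
          ρ′ + 1              ≡⟨ +-comm ρ′ 1 ⟩
          suc ρ′              ≤⟨ ρ′<K ⟩
          K                   ∎

      crossing : Verts → Arcs
      crossing X = D ∩ ((X ∩ S) ∘ tl ∩ (X ∖ S) ∘ hd)

      crossing⁻ : ∀ X a → crossing X a ≡ true → Leaving a × X (tl a) ≡ true × X (hd a) ≡ true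
      crossing⁻ X a = decode (D a) (X (tl a)) (S (tl a)) (X (hd a)) (S (hd a))
        where
        decode : ∀ d xt st xh sh → d ∧ ((xt ∧ st) ∧ (xh ∧ not sh)) ≡ true →
                 (d ≡ true × st ≡ true × sh ≡ false) × xt ≡ true × xh ≡ true
        decode true true true true false _ = (refl , refl , refl) , refl , refl

      arc-into-tight : ∀ X v → X v ≡ true → S v ≡ false → Tight X →
                       ∃ λ a → Leaving a × X (tl a) ≡ true × X (hd a) ≡ true
      arc-into-tight X v Xv Sv (Xr , ρX≤K) =
        map₂ (crossing⁻ X _) (0<∑ₐ[P]⇒∃P (crossing X) (+-cancelˡ-≤ K 1 N K+1≤K+N))
        where
        open ≤-Reasoning
        N = ∑ₐ ([_] ∘ crossing X)
        K+1≤K+N : K + 1 ≤ K + N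
        K+1≤K+N = begin
          K + 1        ≡⟨ +-comm K 1 ⟩
          suc K        ≤⟨ H-connected (X ∖ S) v (cong₂ (λ x s → x ∧ not s) Xv Sv) (cong (_∧ not (S r)) Xr) ⟩
          ρ H (X ∖ S)  ≤⟨ ρ-outside-S (X ∖ S) (λ u → not≡true⇒≡false ∘ x∧y≡true⇒y≡true {X u}) ⟩
          ρ D (X ∖ S)  ≤⟨ ∑ₐ-mono-≤ (λ a → entering-difference (D a) (X (hd a)) (S (hd a)) (X (tl a)) (S (tl a))) ⟩
          ∑ₐ (λ a → [ entering D X a ] + [ crossing X a ])
                       ≡⟨ ∑ₐ-distrib-+ ([_] ∘ entering D X) ([_] ∘ crossing X) ⟩
          ρ D X + N    ≤⟨ +-monoˡ-≤ N ρX≤K ⟩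
          K + N        ∎

      tight-∩ : ∀ {X Z} v → X v ≡ true → Tight X → Tight Z → Tight (X ∩ Z)
      tight-∩ {X} {Z} v Xv (Xr , ρX≤K) (Zr , ρZ≤K) = cong (_∧ Z r) Xr , +-cancelʳ-≤ K (ρ D (X ∩ Z)) K (begin
        ρ D (X ∩ Z) + K            ≤⟨ +-monoʳ-≤ (ρ D (X ∩ Z)) X∪Z-entered ⟩
        ρ D (X ∩ Z) + ρ D (X ∪ Z)  ≤⟨ ρ-submodular D X Z ⟩
        ρ D X + ρ D Z              ≤⟨ +-mono-≤ ρX≤K ρZ≤K ⟩
        K + K                      ∎)
        where
        open ≤-Reasoning
        X∪Z-entered = D-connected (X ∪ Z) v (x≡true⇒x∨y≡true (Z v) Xv) (cong₂ _∨_ Xr Zr)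

      module _ (every-leaving-arc-fails : ∀ a → Leaving a → ∃ (Deficient K (D ∖ ⁅ a ⁆))) where

        tight-set-entered-by : ∀ a → Leaving a → ∃ λ Z → Tight Z × Z (hd a) ≡ true × Z (tl a) ≡ false
        tight-set-entered-by a leaving = map₂ (deficient-after-removal⇒tight a _) (every-leaving-arc-fails a leaving)

        -- A leaving arc a from X ∩ S to X ∖ S enters a tight set Z with tl a ∉ Z, and X ∩ Z is
        -- again tight (tight-∩), reaches outside S and is smaller than X.
        tight-sets-inside-S : ∀ s X → ∣ X ∣ < s → ∀ v → X v ≡ true → S v ≡ false → Tight X → ⊥
        tight-sets-inside-S (suc s) X ∣X∣<1+s v Xv Sv X-tight =
          case arc-into-tight X v Xv Sv X-tight of λ where
            (a , leaving@(_ , _ , Sh) , Xt , Xh) → case tight-set-entered-by a leaving of λ where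
              (Z , Z-tight , Zh , Zt) →
                tight-sets-inside-S s (X ∩ Z)
                  (<-≤-trans (∣∣-mono-< {X} {X ∩ Z} (tl a) (λ u → x∧y≡true⇒x≡true) Xt (cong₂ _∧_ Xt Zt))
                             (≤-pred ∣X∣<1+s))
                  (hd a) (cong₂ _∧_ Xh Zh) Sh (tight-∩ v Xv X-tight Z-tight)

        S-spans : ∀ v → S v ≡ false → ⊥
        S-spans v Sv =
          case 0<∑ₐ[P]⇒∃P (entering D (∁ S)) (≤-trans (s≤s z≤n) ∁S-entered) of λ where
            (a , a-leaves) → case entering⁻ D (∁ S) a a-leaves of λ where
              (Da , ¬Sh , ¬St) →
                case tight-set-entered-by a (Da , not≡false⇒≡true ¬St , not≡true⇒≡false ¬Sh) of λ where
                  (Z , Z-tight , Zh , _) →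
                    tight-sets-inside-S (suc ∣ Z ∣) Z ≤-refl (hd a) Zh (not≡true⇒≡false ¬Sh) Z-tight
          where
          ∁S-entered : suc K ≤ ρ D (∁ S)
          ∁S-entered = ≤-trans (H-connected (∁ S) v (cong not Sv) (cong not r∈S))
                               (ρ-outside-S (∁ S) λ u → not≡true⇒≡false)

      augmenting-arc : ∀ v → S v ≡ false → ∃ λ a → Leaving a × RootedConnected K (D ∖ ⁅ a ⁆)
      augmenting-arc v Sv with anyArc? (λ a → leaving? a ×-dec rootedConnected? K (D ∖ ⁅ a ⁆))
      ... | yes found = found
      ... | no  none  = ⊥-elim (S-spans every-leaving-arc-fails v Sv)
        where
        every-leaving-arc-fails : ∀ a → Leaving a → ∃ (Deficient K (D ∖ ⁅ a ⁆))
        every-leaving-arc-fails a leaving with rootedConnected⊎deficient K (D ∖ ⁅ a ⁆)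
        ... | inj₁ connected = ⊥-elim (none (a , leaving , connected))
        ... | inj₂ deficient = deficient

    two-arc-cycle : ∀ {T : Arcs} a₀ a₁ → T a₀ ≡ true → T a₁ ≡ true → a₀ ≢ a₁ →
                    Step a₁ (hd a₀) (tl a₀) → HasCycle ends T
    two-arc-cycle a₀ a₁ T₀ T₁ a₀≢a₁ back =
      tl a₀ , a₀ , a₁ ∷ [] , uwcons a₀ T₀ (inj₁ (refl , refl)) (uwcons a₁ T₁ back uwnil) , (a₀≢a₁ ∷ []) ∷ [] ∷ []

    parallel-step : ∀ e i d i′ d′ → Step (e , i′ , d′) (hd (e , i , d)) (tl (e , i , d))
    parallel-step e i true  i′ true  = inj₂ (refl , refl)
    parallel-step e i true  i′ false = inj₁ (refl , refl)
    parallel-step e i false i′ true  = inj₁ (refl , refl)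
    parallel-step e i false i′ false = inj₂ (refl , refl)

    arborescence-one-arc-per-edge : ∀ {T} → OutArborescence ends r T → ∀ e i d i′ d′ →
                                    T (e , i , d) ≡ true → T (e , i′ , d′) ≡ true → (i , d) ≡ (i′ , d′)
    arborescence-one-arc-per-edge (acyclic , _) e i d i′ d′ p q with (i , d) ≟ (i′ , d′)
    ... | yes same     = same
    ... | no  distinct = ⊥-elim (acyclic (two-arc-cycle _ _ p q (distinct ∘ cong proj₂) (parallel-step e i d i′ d′)))

    record GrowingArborescence (K : ℕ) (H : Arcs) (S : Verts) (B : Arcs) : Set where
      field
        B⊆H        : ∀ a → B a ≡ true → H a ≡ true
        rest-connected : RootedConnected K (H ∖ B)
        B-within-S : ∀ a → B a ≡ true → S (tl a) ≡ true × S (hd a) ≡ true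
        r∈S        : S r ≡ true
        reaches    : ∀ v → S v ≡ true → DWalk ends B r v
        acyclic    : ¬ HasCycle ends B

    open GrowingArborescence

    start : ∀ {K H} → RootedConnected (suc K) H → GrowingArborescence K H ⁅ r ⁆ ∅
    start {K} {H} connected = record
      { B⊆H            = λ _ ()
      ; rest-connected = λ Z v Zv Zr → ≤-trans (n≤1+n K)
          (subst (suc K ≤_) (ρ-congˡ Z λ a → sym (∧-identityʳ (H a))) (connected Z v Zv Zr))
      ; B-within-S     = λ _ ()
      ; r∈S            = a∈⁅a⁆ r
      ; reaches        = λ v v≡r → subst (DWalk ends ∅ r) (sym (x∈⁅a⁆⇒x≡a v≡r)) dwnil
      ; acyclic        = λ { (_ , _ , _ , uwcons _ () _ _ , _) }
      }

    extend : ∀ {K H S B} → GrowingArborescence K H S B →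
             ∀ a → (H ∖ B) a ≡ true → S (tl a) ≡ true → S (hd a) ≡ false →
             RootedConnected K (H ∖ B ∖ ⁅ a ⁆) → GrowingArborescence K H (S ∪ ⁅ hd a ⁆) (B ∪ ⁅ a ⁆)
    extend {K} {H} {S} {B} G a Da St Sh connected = record
      { B⊆H            = B′⊆H
      ; rest-connected = λ Z v Zv Zr → subst (K ≤_)
          (ρ-congˡ Z λ b → sym (x∧¬[y∨z]≡[x∧¬y]∧¬z (H b) (B b) (⁅ a ⁆ b))) (connected Z v Zv Zr)
      ; B-within-S     = B′-within-S′
      ; r∈S            = x≡true⇒x∨y≡true _ (r∈S G)
      ; reaches        = reaches′
      ; acyclic        = PendantArc.pendant-acyclic (B ∪ ⁅ a ⁆) a pendant B B′∖a⊆B (acyclic G)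
                           λ tl≡hd → hd-a∉S tl≡hd St
      }
      where
      B′-cases : ∀ b → (B ∪ ⁅ a ⁆) b ≡ true → B b ≡ true ⊎ b ≡ a
      B′-cases b p with x∨y≡true⇒x≡true⊎y≡true {B b} p
      ... | inj₁ Bb   = inj₁ Bb
      ... | inj₂ b∈⁅a⁆ = inj₂ (x∈⁅a⁆⇒x≡a b∈⁅a⁆)

      B′∖a⊆B : ∀ b → (B ∪ ⁅ a ⁆) b ≡ true → b ≢ a → B b ≡ true
      B′∖a⊆B b p b≢a with B′-cases b p
      ... | inj₁ Bb  = Bb
      ... | inj₂ b≡a = ⊥-elim (b≢a b≡a)

      B′⊆H : ∀ b → (B ∪ ⁅ a ⁆) b ≡ true → H b ≡ true
      B′⊆H b p with B′-cases b p
      ... | inj₁ Bb   = B⊆H G b Bb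
      ... | inj₂ refl = x∧y≡true⇒x≡true Da

      B′-within-S′ : ∀ b → (B ∪ ⁅ a ⁆) b ≡ true → (S ∪ ⁅ hd a ⁆) (tl b) ≡ true × (S ∪ ⁅ hd a ⁆) (hd b) ≡ true
      B′-within-S′ b p with B′-cases b p
      ... | inj₁ Bb   = x≡true⇒x∨y≡true _ (proj₁ (B-within-S G b Bb)) ,
                        x≡true⇒x∨y≡true _ (proj₂ (B-within-S G b Bb))
      ... | inj₂ refl = x≡true⇒x∨y≡true _ St , y≡true⇒x∨y≡true (S (hd b)) (a∈⁅a⁆ (hd b))

      reaches′ : ∀ v → (S ∪ ⁅ hd a ⁆) v ≡ true → DWalk ends (B ∪ ⁅ a ⁆) r v
      reaches′ v p with x∨y≡true⇒x≡true⊎y≡true {S v} p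
      ... | inj₁ Sv     = DWalk-mono (λ _ → x≡true⇒x∨y≡true _) (reaches G v Sv)
      ... | inj₂ v∈⁅hd⁆ = subst (DWalk ends (B ∪ ⁅ a ⁆) r) (sym (x∈⁅a⁆⇒x≡a v∈⁅hd⁆))
          (DWalk-++ (DWalk-mono (λ _ → x≡true⇒x∨y≡true _) (reaches G (tl a) St))
                    (dwcons a (y≡true⇒x∨y≡true (B a) (a∈⁅a⁆ a)) dwnil))

      hd-a∉S : ∀ {v} → v ≡ hd a → S v ≡ true → ⊥
      hd-a∉S refl Sv = ≢-true-false Sv Sh

      pendant : ∀ b → (B ∪ ⁅ a ⁆) b ≡ true → Incident b (hd a) → b ≡ a
      pendant b p incident with B′-cases b p | incident
      ... | inj₂ b≡a | _            = b≡a
      ... | inj₁ Bb  | inj₁ tl≡hd = ⊥-elim (hd-a∉S tl≡hd (proj₁ (B-within-S G b Bb)))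
      ... | inj₁ Bb  | inj₂ hd≡hd = ⊥-elim (hd-a∉S hd≡hd (proj₂ (B-within-S G b Bb)))

    SpanningArborescenceIn : ℕ → Arcs → Set
    SpanningArborescenceIn K H =
      Σ Arcs λ B → (∀ a → B a ≡ true → H a ≡ true) × RootedConnected K (H ∖ B) × OutArborescence ends r B

    grow : ∀ {K H} → RootedConnected (suc K) H → ∀ fuel {S B} → GrowingArborescence K H S B → ∣ ∁ S ∣ < fuel →
           SpanningArborescenceIn K H
    grow connected (suc fuel) {S} {B} G ∣∁S∣<1+fuel =
      case any? (λ v → S v ≟ false) of λ where
        (no S-full)    → B , B⊆H G , rest-connected G , acyclic G , λ v _ → reaches G v (¬-not (S-full ∘ (v ,_)))
        (yes (v , Sv)) →
          case Augmentation.augmenting-arc connected (rest-connected G) (λ a → proj₂ ∘ B-within-S G a) (r∈S G) v Sv of λ where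
            (a , (Da , St , Sh) , connected′) →
              grow connected fuel (extend G a Da St Sh connected′) (<-≤-trans (∁-shrinks a Sh) (≤-pred ∣∁S∣<1+fuel))
      where
      ∁-shrinks : ∀ a → S (hd a) ≡ false → ∣ ∁ (S ∪ ⁅ hd a ⁆) ∣ < ∣ ∁ S ∣
      ∁-shrinks a Sh = ∣∣-mono-< (hd a) (λ u → ¬[x∨y]⇒¬x (S u) (⁅ hd a ⁆ u)) (cong not Sh)
                                 (cong not (y≡true⇒x∨y≡true (S (hd a)) (a∈⁅a⁆ (hd a))))

    ArborescencePacking : ℕ → Arcs → Set
    ArborescencePacking K H = Σ (Fin K → Arcs) λ Ts →
      (∀ j a → Ts j a ≡ true → H a ≡ true) ×
      (∀ i j a → Ts i a ≡ true → Ts j a ≡ true → i ≡ j) ×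
      (∀ j → OutArborescence ends r (Ts j))

    packing-∷ : ∀ {K H B} → (∀ a → B a ≡ true → H a ≡ true) → OutArborescence ends r B →
                ArborescencePacking K (H ∖ B) → ArborescencePacking (suc K) H
    packing-∷ {K} {H} {B} B⊆H B-arborescence (Ts , Ts⊆H∖B , Ts-disjoint , Ts-arborescences) =
      B Vector.∷ Ts , ⊆H , disjoint , λ { zero → B-arborescence ; (suc j) → Ts-arborescences j }
      where
      ⊆H : ∀ j a → (B Vector.∷ Ts) j a ≡ true → H a ≡ true
      ⊆H zero    a Ba  = B⊆H a Ba
      ⊆H (suc j) a Tja = x∧y≡true⇒x≡true (Ts⊆H∖B j a Tja)

      B∉Ts : ∀ j a → B a ≡ true → Ts j a ≡ true → ⊥
      B∉Ts j a Ba Tja = ≢-true-false Ba (not≡true⇒≡false (x∧y≡true⇒y≡true {H a} (Ts⊆H∖B j a Tja)))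

      disjoint : ∀ i j a → (B Vector.∷ Ts) i a ≡ true → (B Vector.∷ Ts) j a ≡ true → i ≡ j
      disjoint zero    zero    a _ _ = refl
      disjoint zero    (suc j) a p q = ⊥-elim (B∉Ts j a p q)
      disjoint (suc i) zero    a p q = ⊥-elim (B∉Ts i a q p)
      disjoint (suc i) (suc j) a p q = cong suc (Ts-disjoint i j a p q)

    edmonds : ∀ K H → RootedConnected K H → ArborescencePacking K H
    edmonds zero    H connected = (λ ()) , (λ ()) , (λ ()) , (λ ())
    edmonds (suc K) H connected = case grow connected (suc ∣ ∁ ⁅ r ⁆ ∣) (start connected) ≤-refl of λ where
      (B , B⊆H , rest-connected , B-arborescence) →
        packing-∷ B⊆H B-arborescence (edmonds K (H ∖ B) rest-connected)

  crossing-edge-enters : ∀ g x₁ x₂ → x₁ xor x₂ ≡ true → g ≡ true →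
                         0 < [ g ∧ (x₂ ∧ not x₁) ] + [ g ∧ (x₁ ∧ not x₂) ]
  crossing-edge-enters true true  false _ _ = s≤s z≤n
  crossing-edge-enters true false true  _ _ = s≤s z≤n

  []≤ : ∀ {x n} → (x ≡ true → 0 < n) → [ x ] ≤ n
  []≤ {false} _     = z≤n
  []≤ {true}  0<n = 0<n refl

  countFin≡∑ : ∀ n X → countFin n X ≡ ∑ n ([_] ∘ X)
  countFin≡∑ zero    X = refl
  countFin≡∑ (suc n) X = cong ([ X zero ] +_) (countFin≡∑ n (X ∘ suc))

  module CutCondition {k n m : ℕ} (ends : Ends n m) (safe F : Fin m → Bool) (r : Fin n) where

    open Edmonds {n} {m} {k} ends r

    arcsOfD : Arcs
    arcsOfD (e , zero  , _) = F e
    arcsOfD (e , suc _ , _) = F e ∧ safe e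

    arcsOfD⇒InD : ∀ a → arcsOfD a ≡ true → InD k safe F a
    arcsOfD⇒InD (e , zero  , _) Fe = Fe , inj₂ refl
    arcsOfD⇒InD (e , suc _ , _) p  = x∧y≡true⇒x≡true p , inj₁ (x∧y≡true⇒y≡true {F e} p)

    crosses : Verts → Fin m → Bool
    crosses X e = X (proj₁ (ends e)) xor X (proj₂ (ends e))

    walk-crosses : ∀ X {G u v} → EWalk ends G u v → X u ≡ false → X v ≡ true →
                   ∃ λ e → G e ≡ true × crosses X e ≡ true
    walk-crosses X ewnil Xu Xv = ⊥-elim (≢-true-false Xv Xu)
    walk-crosses X (ewcons {w = w} e Ge step walk) Xu Xv with X w in Xw
    ... | false = walk-crosses X walk Xw Xv
    ... | true with step
    ...   | inj₁ (p₁≡u , p₂≡w) = e , Ge , cong₂ _xor_ (trans (cong X p₁≡u) Xu) (trans (cong X p₂≡w) Xw)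
    ...   | inj₂ (p₂≡u , p₁≡w) = e , Ge , cong₂ _xor_ (trans (cong X p₁≡w) Xw) (trans (cong X p₂≡u) Xu)

    copy-block : Verts → Fin m → Fin (suc k) → ℕ
    copy-block X e i = ∑₂ λ d → [ entering arcsOfD X (e , i , d) ]

    edge-block : Verts → Fin m → ℕ
    edge-block X e = ∑ (suc k) (copy-block X e)

    copy-enters : ∀ X e i → crosses X e ≡ true → arcsOfD (e , i , true) ≡ true → 0 < copy-block X e i
    copy-enters X e zero    = crossing-edge-enters (F e)          (X (proj₁ (ends e))) (X (proj₂ (ends e)))
    copy-enters X e (suc _) = crossing-edge-enters (F e ∧ safe e) (X (proj₁ (ends e))) (X (proj₂ (ends e)))

    safe-crossing-edge : ∀ X e → F e ≡ true → safe e ≡ true → crosses X e ≡ true → suc k ≤ ρ arcsOfD X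
    safe-crossing-edge X e Fe safe-e crossing =
      ≤-trans (n≤∑-of-positives (suc k) (copy-block X e) λ i → copy-enters X e i crossing (present i))
              (term≤∑ m (edge-block X) e)
      where
      present : ∀ i → arcsOfD (e , i , true) ≡ true
      present zero    = Fe
      present (suc _) = cong₂ _∧_ Fe safe-e

    crossing-edges≤ρ : ∀ X → ∑ m (λ e → [ F e ∧ crosses X e ]) ≤ ρ arcsOfD X
    crossing-edges≤ρ X = ∑-mono-≤ m λ e → []≤ λ e-crosses →
      ≤-trans (copy-enters X e zero (x∧y≡true⇒y≡true {F e} e-crosses) (x∧y≡true⇒x≡true e-crosses))
              (term≤∑ (suc k) (copy-block X e) zero)

    feasible⇒rootedConnected : FeasibleFGC k ends safe F → RootedConnected (suc k) arcsOfD
    feasible⇒rootedConnected feasible X v Xv Xr =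
      case any? (λ e → Cut e ≟ true ×-dec safe e ≟ true) of λ where
        (yes (e , e∈Cut , safe-e)) →
          safe-crossing-edge X e (x∧y≡true⇒x≡true e∈Cut) safe-e (x∧y≡true⇒y≡true {F e} e∈Cut)
        (no no-safe-edge-in-Cut) → case suc k ≤? ∑ m ([_] ∘ Cut) of λ where
          (yes large-Cut) → ≤-trans large-Cut (crossing-edges≤ρ X)
          (no small-Cut)  → ⊥-elim (Cut-separates (feasible Cut (Cut-unsafe no-safe-edge-in-Cut)
                               (subst (_≤ k) (sym (countFin≡∑ m Cut)) (≮⇒≥ small-Cut)) r v))
      where
      Cut : Fin m → Bool
      Cut e = F e ∧ crosses X e

      Cut-unsafe : ¬ (∃ λ e → Cut e ≡ true × safe e ≡ true) → ∀ e → Cut e ≡ true → F e ≡ true × safe e ≡ false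
      Cut-unsafe no-safe e e∈Cut = x∧y≡true⇒x≡true e∈Cut , ¬-not (λ safe-e → no-safe (e , e∈Cut , safe-e))

      Cut-separates : ¬ EWalk ends (F ∖ Cut) r v
      Cut-separates walk = case walk-crosses X walk Xr Xv of λ where
        (e , e∈F∖Cut , crossing) → ≢-true-false (cong₂ _∧_ (x∧y≡true⇒x≡true e∈F∖Cut) crossing)
                                                (not≡true⇒≡false (x∧y≡true⇒y≡true {F e} e∈F∖Cut))

module Costs where

  open import Algebra.Bundles using (CommutativeMonoid)
  open import Data.Bool using (Bool; true; false; if_then_else_)
  open import Data.Bool.Properties using (_≟_)
  open import Data.Empty using (⊥-elim)
  open import Data.Fin using (Fin; zero; suc)
  open import Data.Fin.Properties using (any?)
  open import Data.Integer as ℤ using (+_)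
  import Data.Integer.Properties as ℤₚ
  open import Data.Nat using (ℕ; zero; suc)
  open import Data.Nat.Coprimality using (1-coprimeTo) renaming (sym to coprime-sym)
  open import Data.Product using (∃; _,_; proj₁)
  open import Data.Rational using (ℚ; 0ℚ; 1ℚ; mkℚ; _+_; _*_; _/_; _≤_)
  open import Data.Rational.Properties
    using (≤-refl; ≤-reflexive; ≤-trans; +-mono-≤; +-monoʳ-≤; +-identityˡ; +-identityʳ; *-identityˡ; *-zeroˡ;
           *-distribʳ-+; +-0-commutativeMonoid; normalize-coprime; toℚᵘ-injective; toℚᵘ-homo-+; module ≤-Reasoning)
  import Data.Rational.Unnormalised as ℚᵘ
  import Data.Rational.Unnormalised.Properties as ℚᵘ
  open import Function using (_∘_; case_of_)
  open import Relation.Binary.PropositionalEquality using (_≡_; refl; sym; trans; cong; cong₂; subst)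
  open import Relation.Nullary.Decidable using (isYes; yes; no)
  open import Algebra.Properties.CommutativeSemigroup
    (CommutativeMonoid.commutativeSemigroup +-0-commutativeMonoid) using (interchange)

  +suc/1≡1+ : ∀ n → + suc n / 1 ≡ 1ℚ + + n / 1
  +suc/1≡1+ n rewrite normalize-coprime (coprime-sym (1-coprimeTo (suc n)))
                    | normalize-coprime (coprime-sym (1-coprimeTo n)) =
    toℚᵘ-injective (ℚᵘ.≃-trans (ℚᵘ.*≡* (cong (λ z → (+ 1 ℤ.+ z) ℤ.* + 1) (sym (ℤₚ.*-identityʳ (+ n)))))
                               (ℚᵘ.≃-sym (toℚᵘ-homo-+ 1ℚ (mkℚ (+ n) 0 (coprime-sym (1-coprimeTo n))))))

  sumFin-cong : ∀ n {f g : Fin n → ℚ} → (∀ i → f i ≡ g i) → sumFin n f ≡ sumFin n g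
  sumFin-cong zero    f≡g = refl
  sumFin-cong (suc n) f≡g = cong₂ _+_ (f≡g zero) (sumFin-cong n (f≡g ∘ suc))

  sumFin-mono-≤ : ∀ n {f g : Fin n → ℚ} → (∀ i → f i ≤ g i) → sumFin n f ≤ sumFin n g
  sumFin-mono-≤ zero    f≤g = ≤-refl
  sumFin-mono-≤ (suc n) f≤g = +-mono-≤ (f≤g zero) (sumFin-mono-≤ n (f≤g ∘ suc))

  sumFin-distrib-+ : ∀ n (f g : Fin n → ℚ) → sumFin n (λ i → f i + g i) ≡ sumFin n f + sumFin n g
  sumFin-distrib-+ zero    f g = sym (+-identityˡ 0ℚ)
  sumFin-distrib-+ (suc n) f g =
    trans (cong (λ s → f zero + g zero + s) (sumFin-distrib-+ n (f ∘ suc) (g ∘ suc)))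
          (interchange (f zero) (g zero) (sumFin n (f ∘ suc)) (sumFin n (g ∘ suc)))

  sumFin-zero : ∀ n {f : Fin n → ℚ} → (∀ i → f i ≡ 0ℚ) → sumFin n f ≡ 0ℚ
  sumFin-zero zero    f≡0 = refl
  sumFin-zero (suc n) f≡0 = trans (cong₂ _+_ (f≡0 zero) (sumFin-zero n (f≡0 ∘ suc))) (+-identityˡ 0ℚ)

  sumFin-swap : ∀ p q (h : Fin p → Fin q → ℚ) →
                sumFin p (λ i → sumFin q (h i)) ≡ sumFin q (λ j → sumFin p (λ i → h i j))
  sumFin-swap zero    q h = sym (sumFin-zero q λ _ → refl)
  sumFin-swap (suc p) q h =
    trans (cong (λ s → sumFin q (h zero) + s) (sumFin-swap p q (h ∘ suc)))
          (sym (sumFin-distrib-+ q (h zero) (λ j → sumFin p (λ i → h (suc i) j))))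

  sumFin-const : ∀ n x → sumFin n (λ _ → x) ≡ (+ n / 1) * x
  sumFin-const zero    x = sym (*-zeroˡ x)
  sumFin-const (suc n) x = begin
    x + sumFin n (λ _ → x)       ≡⟨ cong₂ _+_ (sym (*-identityˡ x)) (sumFin-const n x) ⟩
    1ℚ * x + (+ n / 1) * x      ≡⟨ *-distribʳ-+ x 1ℚ (+ n / 1) ⟨
    (1ℚ + + n / 1) * x          ≡⟨ cong (_* x) (+suc/1≡1+ n) ⟨
    (+ suc n / 1) * x           ∎
    where open Relation.Binary.PropositionalEquality.≡-Reasoning

  sumFin-nonneg : ∀ n {f : Fin n → ℚ} → (∀ i → 0ℚ ≤ f i) → 0ℚ ≤ sumFin n f
  sumFin-nonneg zero    f≥0 = ≤-refl
  sumFin-nonneg (suc n) f≥0 =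
    ≤-trans (≤-reflexive (sym (+-identityˡ 0ℚ))) (+-mono-≤ (f≥0 zero) (sumFin-nonneg n (f≥0 ∘ suc)))

  term≤sumFin : ∀ n {f : Fin n → ℚ} → (∀ i → 0ℚ ≤ f i) → ∀ i → f i ≤ sumFin n f
  term≤sumFin (suc n) {f} f≥0 zero    =
    ≤-trans (≤-reflexive (sym (+-identityʳ (f zero)))) (+-monoʳ-≤ (f zero) (sumFin-nonneg n (f≥0 ∘ suc)))
  term≤sumFin (suc n) {f} f≥0 (suc i) =
    ≤-trans (≤-reflexive (sym (+-identityˡ (f (suc i))))) (+-mono-≤ (f≥0 zero) (term≤sumFin n (f≥0 ∘ suc) i))

  if-nonneg : ∀ b {x} → 0ℚ ≤ x → 0ℚ ≤ (if b then x else 0ℚ)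
  if-nonneg true  x≥0 = x≥0
  if-nonneg false _   = ≤-refl

  ⋃ : ∀ {K} {A : Set} → (Fin K → A → Bool) → A → Bool
  ⋃ Ts a = isYes (any? λ j → Ts j a ≟ true)

  ⋃⁻ : ∀ {K} {A : Set} (Ts : Fin K → A → Bool) {a} → ⋃ Ts a ≡ true → ∃ λ j → Ts j a ≡ true
  ⋃⁻ Ts {a} _ with any? (λ j → Ts j a ≟ true)
  ... | yes found = found

  ⋃⁺ : ∀ {K} {A : Set} (Ts : Fin K → A → Bool) {a} j → Ts j a ≡ true → ⋃ Ts a ≡ true
  ⋃⁺ Ts {a} j Tja with any? (λ j → Ts j a ≟ true)
  ... | yes _   = refl
  ... | no none = ⊥-elim (none (j , Tja))

  if-⋃-≤-sum : ∀ {K} {A : Set} (Ts : Fin K → A → Bool) a {x} → 0ℚ ≤ x →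
               (if ⋃ Ts a then x else 0ℚ) ≤ sumFin K (λ j → if Ts j a then x else 0ℚ)
  if-⋃-≤-sum {K} Ts a {x} x≥0 with any? (λ j → Ts j a ≟ true)
  ... | yes (j , Tja) = subst (λ b → (if b then x else 0ℚ) ≤ sumFin K (λ j → if Ts j a then x else 0ℚ)) Tja
                              (term≤sumFin K (λ j → if-nonneg (Ts j a) x≥0) j)
  ... | no  _         = sumFin-nonneg K (λ j → if-nonneg (Ts j a) x≥0)

  module _ {m k : ℕ} where

    sumArcs-mono-≤ : ∀ {f g : Arc m k → ℚ} → (∀ a → f a ≤ g a) → sumArcs m k f ≤ sumArcs m k g
    sumArcs-mono-≤ f≤g =
      sumFin-mono-≤ m λ e → sumFin-mono-≤ (suc k) λ i → +-mono-≤ (f≤g (e , i , true)) (f≤g (e , i , false))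

    sumArcs-swap : ∀ K (g : Fin K → Arc m k → ℚ) →
                   sumArcs m k (λ a → sumFin K (λ j → g j a)) ≡ sumFin K (λ j → sumArcs m k (g j))
    sumArcs-swap K g = trans
      (sumFin-cong m λ e → trans
        (sumFin-cong (suc k) λ i → sym (sumFin-distrib-+ K (λ j → g j (e , i , true)) (λ j → g j (e , i , false))))
        (sumFin-swap (suc k) K λ i j → g j (e , i , true) + g j (e , i , false)))
      (sumFin-swap m K λ e j → sumFin (suc k) λ i → g j (e , i , true) + g j (e , i , false))

    costArcs-⋃ : ∀ K (c : Fin m → ℚ) → (∀ e → 0ℚ ≤ c e) → (Ts : Fin K → Arc m k → Bool) →
                 costArcs c (⋃ Ts) ≤ sumFin K (λ j → costArcs c (Ts j))
    costArcs-⋃ K c c≥0 Ts = ≤-trans (sumArcs-mono-≤ λ a → if-⋃-≤-sum Ts a (c≥0 (proj₁ a)))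
                                   (≤-reflexive (sumArcs-swap K λ j a → if Ts j a then costA c a else 0ℚ))

  Exclusive : ∀ {p} → (Fin p → Bool → Bool) → Set
  Exclusive b = ∀ i d i′ d′ → b i d ≡ true → b i′ d′ ≡ true → (i , d) ≡ (i′ , d′)

  Exclusive-tail : ∀ {p} {b : Fin (suc p) → Bool → Bool} → Exclusive b → Exclusive (b ∘ suc)
  Exclusive-tail exclusive i d i′ d′ p q with exclusive (suc i) d (suc i′) d′ p q
  ... | refl = refl

  exclusive-rest-vanishes : ∀ p (b : Fin (suc p) → Bool → Bool) {x} → Exclusive b → ∀ d → b zero d ≡ true →
    sumFin p (λ i → (if b (suc i) true then x else 0ℚ) + (if b (suc i) false then x else 0ℚ)) ≡ 0ℚ
  exclusive-rest-vanishes p b {x} exclusive d b₀d =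
    sumFin-zero p λ i → trans (cong₂ _+_ (vanishes i true) (vanishes i false)) (+-identityˡ 0ℚ)
    where
    vanishes : ∀ i d′ → (if b (suc i) d′ then x else 0ℚ) ≡ 0ℚ
    vanishes i d′ with b (suc i) d′ in bᵢd′
    ... | true  = case exclusive zero d (suc i) d′ b₀d bᵢd′ of λ ()
    ... | false = refl

  sumFin-exclusive-≤ : ∀ p (b : Fin p → Bool → Bool) {x} → 0ℚ ≤ x → Exclusive b →
                       sumFin p (λ i → (if b i true then x else 0ℚ) + (if b i false then x else 0ℚ)) ≤ x
  sumFin-exclusive-≤ zero    b x≥0 exclusive = x≥0
  sumFin-exclusive-≤ (suc p) b {x} x≥0 exclusive with b zero true in b₀t | b zero false in b₀f
  ... | true  | true  = case exclusive zero true zero false b₀t b₀f of λ ()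
  ... | true  | false = ≤-reflexive (trans (cong₂ _+_ (+-identityʳ x) (exclusive-rest-vanishes p b exclusive true b₀t))
                                           (+-identityʳ x))
  ... | false | true  = ≤-reflexive (trans (cong₂ _+_ (+-identityˡ x) (exclusive-rest-vanishes p b exclusive false b₀f))
                                           (+-identityʳ x))
  ... | false | false = ≤-trans (≤-reflexive (+-identityˡ _)) (sumFin-exclusive-≤ p (b ∘ suc) x≥0 (Exclusive-tail exclusive))

  costArcs-≤-costE : ∀ {m k} (c : Fin m → ℚ) → (∀ e → 0ℚ ≤ c e) → (F : Fin m → Bool) (T : Arc m k → Bool) →
                     (∀ e i d → T (e , i , d) ≡ true → F e ≡ true) → (∀ e → Exclusive λ i d → T (e , i , d)) →
                     costArcs c T ≤ costE c F
  costArcs-≤-costE {m} {k} c c≥0 F T T⊆F one-arc-per-edge = sumFin-mono-≤ m per-edge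
    where
    per-edge : ∀ e → sumFin (suc k) (λ i → (if T (e , i , true) then c e else 0ℚ) + (if T (e , i , false) then c e else 0ℚ))
                     ≤ (if F e then c e else 0ℚ)
    per-edge e with F e in Fe
    ... | true  = sumFin-exclusive-≤ (suc k) (λ i d → T (e , i , d)) (c≥0 e) (one-arc-per-edge e)
    ... | false = ≤-reflexive (sumFin-zero (suc k) λ i → trans (cong₂ _+_ (absent i true) (absent i false)) (+-identityˡ 0ℚ))
      where
      absent : ∀ i d → (if T (e , i , d) then c e else 0ℚ) ≡ 0ℚ
      absent i d with T (e , i , d) in Teid
      ... | true  = case trans (sym (T⊆F e i d Teid)) Fe of λ ()
      ... | false = refl

  packing-cost : ∀ {m k K} (c : Fin m → ℚ) → (∀ e → 0ℚ ≤ c e) →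
                 (F : Fin m → Bool) (Ts : Fin K → Arc m k → Bool) →
                 (∀ j e i d → Ts j (e , i , d) ≡ true → F e ≡ true) → (∀ j e → Exclusive λ i d → Ts j (e , i , d)) →
                 costArcs c (⋃ Ts) ≤ (+ K / 1) * costE c F
  packing-cost {K = K} c c≥0 F Ts Ts⊆F one-arc-per-edge = begin
    costArcs c (⋃ Ts)                    ≤⟨ costArcs-⋃ K c c≥0 Ts ⟩
    sumFin K (λ j → costArcs c (Ts j))  ≤⟨ sumFin-mono-≤ K (λ j →
                                             costArcs-≤-costE c c≥0 F (Ts j) (Ts⊆F j) (one-arc-per-edge j)) ⟩
    sumFin K (λ _ → costE c F)          ≡⟨ sumFin-const K (costE c F) ⟩
    (+ K / 1) * costE c F                ∎
    where open ≤-Reasoning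

open Arborescences using (module Edmonds; module CutCondition)
open Costs using (⋃; ⋃⁻; ⋃⁺; packing-cost)
open import Data.Nat using (ℕ; suc; _≥_)
open import Data.Fin using (Fin)
open import Data.Bool using (Bool)
open import Data.Integer using (+_)
open import Data.Rational using (ℚ; 0ℚ; _≤_; _*_; _/_)
open import Data.Product using (_,_; proj₁; proj₂)
open import Function using (_∘_; case_of_)

lemma1 : (k : ℕ) → k ≥ 1 → (n m : ℕ) → (ends : Ends n m) → NoLoops ends →
    (safe : Fin m → Bool) → (c : Fin m → ℚ) → (∀ e → 0ℚ ≤ c e) →
    (r : Fin n) → (F : Fin m → Bool) → FeasibleFGC k ends safe F →
    HasOutKArborescence k ends safe F c r (((+ suc k) / 1) * costE c F)
lemma1 k _ n m ends _ safe c c≥0 r F feasible =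
  case edmonds (suc k) arcsOfD (feasible⇒rootedConnected feasible) of λ where
    (Ts , Ts⊆D , disjoint , arborescences) →
      ⋃ Ts , Ts , (λ a p → arcsOfD⇒InD a (Ts⊆D _ a (proj₂ (⋃⁻ Ts p)))) , (λ _ → ⋃⁻ Ts) , (λ j _ → ⋃⁺ Ts j) ,
      disjoint , arborescences ,
      packing-cost c c≥0 F Ts (λ j e i d → proj₁ ∘ arcsOfD⇒InD (e , i , d) ∘ Ts⊆D j (e , i , d))
                   (arborescence-one-arc-per-edge ∘ arborescences)
  where
  open Edmonds {n} {m} {k} ends r
  open CutCondition {k} ends safe F r
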